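{- Let $l$ and $n$ be positive integers and $\varepsilon\in\{1,-1\}$. Then the polynomial $$ \frac{1}{n}\sum_{k=0}^{n-1}\varepsilon^k (2k+1)^{2l-1}\sum_{j=0}^{k}{ -x-1\choose j}^2{x\choose k-j}^2 $$ in $\mathbb{Q}[x]$ is integer-valued, i.e., it takes an integer value at every $x\in\mathbb{Z}$.
   Context: For a variable $x$ and a non-negative integer $k$, ${x\choose k}$ denotes the polynomial $x(x-1)\cdots(x-k+1)/k!$ (equal to $1$ for $k=0$), and ${ -x-1\choose k}$ is this polynomial evaluated at $-x-1$. A polynomial $P(x)\in\mathbb{Q}[x]$ is called integer-valued if $P(x)\in\mathbb{Z}$ for all $x\in\mathbb{Z}$. -}

module Defs where

open import Data.Nat using (ℕ; zero; suc)
open import Data.Integer using (ℤ; +_)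
open import Data.Rational using (ℚ; _+_; _*_; _-_; _/_; 0ℚ; 1ℚ)

sumTo : ℕ → (ℕ → ℚ) → ℚ
sumTo zero    f = 0ℚ
sumTo (suc n) f = sumTo n f + f n

pow : ℚ → ℕ → ℚ
pow q zero    = 1ℚ
pow q (suc k) = pow q k * q

ℕtoℚ : ℕ → ℚ
ℕtoℚ m = (+ m) / 1

ℤtoℚ : ℤ → ℚ
ℤtoℚ z = z / 1

choose : ℚ → ℕ → ℚ
choose x zero    = 1ℚ
choose x (suc k) = choose x k * (x - ℕtoℚ k) * ((+ 1) / suc k)

-- the polynomial of the theorem, evaluated at x:
-- (1/n) Σ_{k=0}^{n-1} ε^k (2k+1)^{2l-1} Σ_{j=0}^{k} C(-x-1,j)^2 C(x,k-j)^2
-- (l is assumed ≥ 1, so 2l-1 = 2(l-1)+1 is written with natural subtraction ∸.)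
open import Data.Nat using (_∸_; NonZero) renaming (_+_ to _+ℕ_; _*_ to _*ℕ_)
open import Data.Rational using (-_)

P : (l n : ℕ) → .{{NonZero n}} → (ε : ℚ) → ℚ → ℚ
P l n ε x =
  ((+ 1) / n) *
  sumTo n (λ k →
    pow ε k * pow (ℕtoℚ (2 *ℕ k +ℕ 1)) (2 *ℕ l ∸ 1) *
    sumTo (suc k) (λ j →
      pow (choose (- x - 1ℚ) j) 2 * pow (choose x (k ∸ j)) 2))

-- For x = N ≥ 0 we have C(-x-1, j) = (-1)^j C(N+j, j), so the inner sum is
-- F(N,k) = Σ_j C(N+j,j)² C(N,k-j)²; replacing x by -x-1 and j by k-j leaves the inner sum
-- unchanged, which handles x < 0. Both F(N,k) and G(N,k) = Σ_m C(k,m)C(k+m,m)C(N,m)C(N+m,m)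
-- satisfy
--   (N+1)³ u(N+1,k) = (k+1)³ u(N,k+1) + (N-k)(N²-Nk+k²+N+k+1) u(N,k),
-- termwise up to a telescoping Wilf–Zeilberger certificate, and both equal 1 at N = 0; hence
-- F = G. Exchanging the summations, n P(x) = Σ_m C(N,m)C(N+m,m) S(m) with
-- S(m) = Σ_{k<n} ε^k (2k+1)^(2l-1) C(k,m)C(k+m,m). For the exponent 1, S(m) telescopes to
-- n C(n,m+1)C(n+m,m) if ε = 1 and to (-1)^(n-1) n C(n-1,m)C(n+m,m) if ε = -1, and
--   (2k+1)² C(k,m)C(k+m,m) = 4(m+1)² C(k,m+1)C(k+m+1,m+1) + (2m+1)² C(k,m)C(k+m,m)
-- raises the exponent by two while keeping S(m) divisible by n.

module Submission where

open import Defs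
open import Data.Nat as ℕ using (ℕ; zero; suc; _∸_; NonZero; _≥_; s≤s; z≤n)
import Data.Nat.Properties as ℕP
open import Data.Nat.Combinatorics
  using (_C_; nCk+nC[k+1]≡[n+1]C[k+1]; k>n⇒nCk≡0; nCn≡1; nC1≡n; nCk≡nC[n∸k])
open import Data.Integer as ℤ using (ℤ; +_; -[1+_]; 0ℤ; 1ℤ; -1ℤ; _+_; _*_; _-_; _^_)
import Data.Integer.Properties as ℤP
open import Data.Integer.Divisibility.Signed using (_∣_; divides; quotient; ∣m∣n⇒∣m+n; ∣n⇒∣m*n)
open import Data.Integer.Tactic.RingSolver using (solve-∀; solve)
open import Data.List.Base using (_∷_; [])
import Data.Nat.Coprimality as Coprimality
open import Data.Rational as ℚ using (ℚ; mkℚ; 1ℚ; -_)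
import Data.Rational.Properties as ℚP
open import Data.Product using (∃; _,_; _×_; proj₁; proj₂)
open import Data.Sum using (_⊎_; inj₁; inj₂)
open import Relation.Binary.PropositionalEquality
open ≡-Reasoning

nC0≡1 : ∀ n → n C 0 ≡ 1
nC0≡1 n = trans (nCk≡nC[n∸k] {n = n} z≤n) (nCn≡1 n)

[1+k]*[1+n]C[1+k]≡[1+n]*nCk : ∀ n k → suc k ℕ.* (suc n C suc k) ≡ suc n ℕ.* (n C k)
[1+k]*[1+n]C[1+k]≡[1+n]*nCk n zero = begin
  1 ℕ.* (suc n C 1)  ≡⟨ ℕP.*-identityˡ (suc n C 1) ⟩
  suc n C 1          ≡⟨ nC1≡n (suc n) ⟩
  suc n              ≡⟨ ℕP.*-identityʳ (suc n) ⟨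
  suc n ℕ.* 1        ≡⟨ cong (suc n ℕ.*_) (nC0≡1 n) ⟨
  suc n ℕ.* (n C 0)  ∎
[1+k]*[1+n]C[1+k]≡[1+n]*nCk zero (suc k)
  rewrite k>n⇒nCk≡0 {1} {suc (suc k)} (s≤s (s≤s z≤n)) | k>n⇒nCk≡0 {0} {suc k} (s≤s z≤n)
  = ℕP.*-zeroʳ (suc (suc k))
[1+k]*[1+n]C[1+k]≡[1+n]*nCk (suc n) (suc k) = begin
  suc (suc k) ℕ.* (suc (suc n) C suc (suc k))
    ≡⟨ cong (suc (suc k) ℕ.*_) (nCk+nC[k+1]≡[n+1]C[k+1] (suc n) (suc k)) ⟨
  suc (suc k) ℕ.* (c ℕ.+ suc n C suc (suc k))
    ≡⟨ ℕP.*-distribˡ-+ (suc (suc k)) c (suc n C suc (suc k)) ⟩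
  (c ℕ.+ suc k ℕ.* c) ℕ.+ suc (suc k) ℕ.* (suc n C suc (suc k))
    ≡⟨ cong₂ (λ u v → (c ℕ.+ u) ℕ.+ v)
         ([1+k]*[1+n]C[1+k]≡[1+n]*nCk n k) ([1+k]*[1+n]C[1+k]≡[1+n]*nCk n (suc k)) ⟩
  (c ℕ.+ suc n ℕ.* (n C k)) ℕ.+ suc n ℕ.* (n C suc k)
    ≡⟨ ℕP.+-assoc c (suc n ℕ.* (n C k)) (suc n ℕ.* (n C suc k)) ⟩
  c ℕ.+ (suc n ℕ.* (n C k) ℕ.+ suc n ℕ.* (n C suc k))
    ≡⟨ cong (c ℕ.+_) (ℕP.*-distribˡ-+ (suc n) (n C k) (n C suc k)) ⟨
  c ℕ.+ suc n ℕ.* (n C k ℕ.+ n C suc k)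
    ≡⟨ cong (λ u → c ℕ.+ suc n ℕ.* u) (nCk+nC[k+1]≡[n+1]C[k+1] n k) ⟩
  suc (suc n) ℕ.* c ∎
  where
  c : ℕ
  c = suc n C suc k

binom : ℕ → ℕ → ℤ
binom n k = + (n C k)

-- C(-n-1, j) = (-1)^j binomNeg n j
binomNeg : ℕ → ℕ → ℤ
binomNeg n j = + ((n ℕ.+ j) C j)

pos-*-cong : ∀ a b c d → a ℕ.* b ≡ c ℕ.* d → + a * + b ≡ + c * + d
pos-*-cong a b c d eq = trans (sym (ℤP.pos-* a b)) (trans (cong +_ eq) (ℤP.pos-* c d))

-- Below, n + 1 is written 1ℤ + + n, which reduces to + suc n but is a polynomial in + n for
-- the ring solver.

binom-zero : ∀ n → binom n 0 ≡ 1ℤ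
binom-zero n = cong +_ (nC0≡1 n)

binom-vanish : ∀ {n k} → n ℕ.< k → binom n k ≡ 0ℤ
binom-vanish n<k = cong +_ (k>n⇒nCk≡0 n<k)

binom-pascal : ∀ n k → binom (suc n) (suc k) ≡ binom n k + binom n (suc k)
binom-pascal n k = cong +_ (sym (nCk+nC[k+1]≡[n+1]C[k+1] n k))

binom-absorb : ∀ n k → (1ℤ + + k) * binom (suc n) (suc k) ≡ (1ℤ + + n) * binom n k
binom-absorb n k = pos-*-cong (suc k) (suc n C suc k) (suc n) (n C k) ([1+k]*[1+n]C[1+k]≡[1+n]*nCk n k)

binom-step : ∀ n k → (1ℤ + + k) * binom n (suc k) ≡ (+ n - + k) * binom n k
binom-step n k = from-pascal (+ n) (+ k) (binom n k) (binom n (suc k)) _ (binom-pascal n k) (binom-absorb n k)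
  where
  from-pascal : ∀ n k c c′ c₁ → c₁ ≡ c + c′ → (1ℤ + k) * c₁ ≡ (1ℤ + n) * c →
                (1ℤ + k) * c′ ≡ (n - k) * c
  from-pascal n k c c′ _ refl h = begin
    (1ℤ + k) * c′                       ≡⟨ solve (k ∷ c ∷ c′ ∷ []) ⟩
    (1ℤ + k) * (c + c′) - (1ℤ + k) * c  ≡⟨ cong (_- (1ℤ + k) * c) h ⟩
    (1ℤ + n) * c - (1ℤ + k) * c         ≡⟨ solve (n ∷ k ∷ c ∷ []) ⟩
    (n - k) * c                         ∎

binom-row : ∀ n k → (1ℤ + + n - + k) * binom (suc n) k ≡ (1ℤ + + n) * binom n k
binom-row n zero = cong₂ _*_ (ℤP.+-identityʳ (1ℤ + + n)) (trans (binom-zero (suc n)) (sym (binom-zero n)))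
binom-row n (suc i) = ℤP.*-cancelˡ-≡ (1ℤ + + i) _ _
  (row (+ n) (+ i) (binom n i) (binom n (suc i)) (binom (suc n) (suc i)) (binom-absorb n i) (binom-step n i))
  where
  row : ∀ n i c c′ c₁ → (1ℤ + i) * c₁ ≡ (1ℤ + n) * c → (1ℤ + i) * c′ ≡ (n - i) * c →
        (1ℤ + i) * ((1ℤ + n - (1ℤ + i)) * c₁) ≡ (1ℤ + i) * ((1ℤ + n) * c′)
  row n i c c′ c₁ h₁ h₂ = begin
    (1ℤ + i) * ((1ℤ + n - (1ℤ + i)) * c₁) ≡⟨ solve (n ∷ i ∷ c₁ ∷ []) ⟩
    (n - i) * ((1ℤ + i) * c₁)              ≡⟨ cong ((n - i) *_) h₁ ⟩
    (n - i) * ((1ℤ + n) * c)               ≡⟨ solve (n ∷ i ∷ c ∷ []) ⟩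
    (1ℤ + n) * ((n - i) * c)               ≡⟨ cong ((1ℤ + n) *_) h₂ ⟨
    (1ℤ + n) * ((1ℤ + i) * c′)             ≡⟨ solve (n ∷ i ∷ c′ ∷ []) ⟩
    (1ℤ + i) * ((1ℤ + n) * c′)             ∎

binomNeg-zero : ∀ n → binomNeg n 0 ≡ 1ℤ
binomNeg-zero n = cong +_ (nC0≡1 (n ℕ.+ 0))

binomNeg-origin : ∀ j → binomNeg 0 j ≡ 1ℤ
binomNeg-origin j = cong +_ (nCn≡1 j)

binomNeg-step : ∀ n j → (1ℤ + + j) * binomNeg n (suc j) ≡ (1ℤ + + n + + j) * binomNeg n j
binomNeg-step n j = pos-*-cong (suc j) ((n ℕ.+ suc j) C suc j) (suc (n ℕ.+ j)) ((n ℕ.+ j) C j) (begin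
  suc j ℕ.* ((n ℕ.+ suc j) C suc j)  ≡⟨ cong (λ m → suc j ℕ.* (m C suc j)) (ℕP.+-suc n j) ⟩
  suc j ℕ.* (suc (n ℕ.+ j) C suc j)  ≡⟨ [1+k]*[1+n]C[1+k]≡[1+n]*nCk (n ℕ.+ j) j ⟩
  suc (n ℕ.+ j) ℕ.* ((n ℕ.+ j) C j)  ∎)

binomNeg-row : ∀ n j → (1ℤ + + n) * binomNeg (suc n) j ≡ (1ℤ + + n + + j) * binomNeg n j
binomNeg-row n j = pos-*-cong (suc n) (suc (n ℕ.+ j) C j) (suc (n ℕ.+ j)) ((n ℕ.+ j) C j) (begin
  suc n ℕ.* (suc (n ℕ.+ j) C j)      ≡⟨ cong (suc n ℕ.*_) (symmetric (suc n) j) ⟩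
  suc n ℕ.* (suc (n ℕ.+ j) C suc n)  ≡⟨ [1+k]*[1+n]C[1+k]≡[1+n]*nCk (n ℕ.+ j) n ⟩
  suc (n ℕ.+ j) ℕ.* ((n ℕ.+ j) C n)  ≡⟨ cong (suc (n ℕ.+ j) ℕ.*_) (symmetric n j) ⟨
  suc (n ℕ.+ j) ℕ.* ((n ℕ.+ j) C j)  ∎)
  where
  symmetric : ∀ a b → (a ℕ.+ b) C b ≡ (a ℕ.+ b) C a
  symmetric a b = trans (nCk≡nC[n∸k] (ℕP.m≤n+m b a)) (cong ((a ℕ.+ b) C_) (ℕP.m+n∸n≡m a b))

∑ : ℕ → (ℕ → ℤ) → ℤ
∑ zero    f = 0ℤ
∑ (suc n) f = ∑ n f + f n

∑-cong : ∀ n {f g : ℕ → ℤ} → (∀ j → j ℕ.< n → f j ≡ g j) → ∑ n f ≡ ∑ n g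
∑-cong zero    f≡g = refl
∑-cong (suc n) f≡g = cong₂ _+_ (∑-cong n (λ j j<n → f≡g j (ℕP.m<n⇒m<1+n j<n))) (f≡g n (ℕP.n<1+n n))

∑-zero : ∀ n {f : ℕ → ℤ} → (∀ j → j ℕ.< n → f j ≡ 0ℤ) → ∑ n f ≡ 0ℤ
∑-zero n f≡0 = trans (∑-cong n f≡0) (∑-zero′ n)
  where
  ∑-zero′ : ∀ n → ∑ n (λ _ → 0ℤ) ≡ 0ℤ
  ∑-zero′ zero    = refl
  ∑-zero′ (suc n) = cong (_+ 0ℤ) (∑-zero′ n)

∑-pad : ∀ {n m} {f : ℕ → ℤ} → (∀ j → n ℕ.≤ j → f j ≡ 0ℤ) → n ℕ.≤ m → ∑ m f ≡ ∑ n f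
∑-pad f≡0 n≤m with ℕP.m≤n⇒m<n∨m≡n n≤m
... | inj₂ refl = refl
∑-pad {n} {suc m} {f} f≡0 n≤m | inj₁ n<1+m = begin
  ∑ m f + f m   ≡⟨ cong (_+_ (∑ m f)) (f≡0 m (ℕP.≤-pred n<1+m)) ⟩
  ∑ m f + 0ℤ    ≡⟨ ℤP.+-identityʳ (∑ m f) ⟩
  ∑ m f         ≡⟨ ∑-pad f≡0 (ℕP.≤-pred n<1+m) ⟩
  ∑ n f         ∎

∑-suc : ∀ n (f : ℕ → ℤ) → ∑ (suc n) f ≡ f 0 + ∑ n (λ j → f (suc j))
∑-suc zero    f = ℤP.+-comm 0ℤ (f 0)
∑-suc (suc n) f = trans (cong (_+ f (suc n)) (∑-suc n f)) (ℤP.+-assoc (f 0) _ _)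

∑-reverse : ∀ n (f : ℕ → ℤ) → ∑ n f ≡ ∑ n (λ j → f (n ∸ suc j))
∑-reverse zero    f = refl
∑-reverse (suc n) f = begin
  ∑ n f + f n                          ≡⟨ cong (_+ f n) (∑-reverse n f) ⟩
  ∑ n (λ j → f (n ∸ suc j)) + f n      ≡⟨ ℤP.+-comm _ (f n) ⟩
  f n + ∑ n (λ j → f (n ∸ suc j))      ≡⟨ ∑-suc n (λ j → f (n ∸ j)) ⟨
  ∑ (suc n) (λ j → f (n ∸ j))          ∎

*-distribˡ-∑ : ∀ n c (f : ℕ → ℤ) → c * ∑ n f ≡ ∑ n (λ j → c * f j)
*-distribˡ-∑ zero    c f = ℤP.*-zeroʳ c
*-distribˡ-∑ (suc n) c f = trans (ℤP.*-distribˡ-+ c (∑ n f) (f n)) (cong (_+ c * f n) (*-distribˡ-∑ n c f))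

∑-distrib-+ : ∀ n (f g : ℕ → ℤ) → ∑ n (λ j → f j + g j) ≡ ∑ n f + ∑ n g
∑-distrib-+ zero    f g = refl
∑-distrib-+ (suc n) f g = trans (cong (_+ (f n + g n)) (∑-distrib-+ n f g)) (regroup (∑ n f) (∑ n g) (f n) (g n))
  where
  regroup : ∀ F G x y → F + G + (x + y) ≡ F + x + (G + y)
  regroup = solve-∀

∑-linear : ∀ n a b (f g : ℕ → ℤ) → ∑ n (λ j → a * f j + b * g j) ≡ a * ∑ n f + b * ∑ n g
∑-linear n a b f g =
  trans (∑-distrib-+ n _ _) (sym (cong₂ _+_ (*-distribˡ-∑ n a f) (*-distribˡ-∑ n b g)))

∑-comm : ∀ n m (f : ℕ → ℕ → ℤ) → ∑ n (λ k → ∑ m (f k)) ≡ ∑ m (λ j → ∑ n (λ k → f k j))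
∑-comm zero    m f = sym (∑-zero m (λ _ _ → refl))
∑-comm (suc n) m f = begin
  ∑ n (λ k → ∑ m (f k)) + ∑ m (f n)                   ≡⟨ cong (_+ ∑ m (f n)) (∑-comm n m f) ⟩
  ∑ m (λ j → ∑ n (λ k → f k j)) + ∑ m (f n)           ≡⟨ ∑-distrib-+ m _ (f n) ⟨
  ∑ m (λ j → ∑ (suc n) (λ k → f k j))                 ∎

∑-recurrence : ∀ n a b c (f g h V : ℕ → ℤ) →
  (∀ j → j ℕ.< n → a * f j ≡ b * g j + c * h j + (V (suc j) - V j)) →
  a * ∑ n f ≡ b * ∑ n g + c * ∑ n h + (V n - V 0)
∑-recurrence zero    a b c f g h V _    = empty a b c (V 0)
  where
  empty : ∀ a b c v → a * 0ℤ ≡ b * 0ℤ + c * 0ℤ + (v - v)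
  empty = solve-∀
∑-recurrence (suc n) a b c f g h V step = begin
  a * (∑ n f + f n)    ≡⟨ ℤP.*-distribˡ-+ a (∑ n f) (f n) ⟩
  a * ∑ n f + a * f n  ≡⟨ cong₂ _+_ (∑-recurrence n a b c f g h V (λ j j<n → step j (ℕP.m<n⇒m<1+n j<n)))
                                    (step n (ℕP.n<1+n n)) ⟩
  b * ∑ n g + c * ∑ n h + (V n - V 0) + (b * g n + c * h n + (V (suc n) - V n))
    ≡⟨ regroup b c (∑ n g) (∑ n h) (g n) (h n) (V 0) (V n) (V (suc n)) ⟩
  b * (∑ n g + g n) + c * (∑ n h + h n) + (V (suc n) - V 0) ∎
  where
  regroup : ∀ b c G H x y v₀ v v′ →
    b * G + c * H + (v - v₀) + (b * x + c * y + (v′ - v)) ≡ b * (G + x) + c * (H + y) + (v′ - v₀)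
  regroup = solve-∀

∣-∑ : ∀ {d} n {f : ℕ → ℤ} → (∀ j → d ∣ f j) → d ∣ ∑ n f
∣-∑ zero    d∣f = divides 0ℤ refl
∣-∑ (suc n) d∣f = ∣m∣n⇒∣m+n (∣-∑ n d∣f) (d∣f n)

-- Linear combinations of equations

infixr 5 _·_∷_
data Vanishing : ℤ → Set where
  []    : Vanishing 0ℤ
  _·_∷_ : ∀ {u v c} w → u ≡ v → Vanishing c → Vanishing (w * (u - v) + c)

vanishes : ∀ {x c} → Vanishing c → x ≡ c → x ≡ 0ℤ
vanishes []                      x≡0 = x≡0
vanishes (_·_∷_ {u} w refl rest) x≡c =
  trans x≡c (cong₂ _+_ (trans (cong (w *_) (ℤP.+-inverseʳ u)) (ℤP.*-zeroʳ w)) (vanishes rest refl))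

*≡0⇒≡0 : ∀ s .{{_ : ℤ.NonZero s}} {x} → s * x ≡ 0ℤ → x ≡ 0ℤ
*≡0⇒≡0 s {x} s*x≡0 = ℤP.*-cancelˡ-≡ s x 0ℤ (trans s*x≡0 (sym (ℤP.*-zeroʳ s)))

sq : ℤ → ℤ
sq x = x * x

cube : ℤ → ℤ
cube x = x * x * x

β : ℤ → ℤ → ℤ
β n k = (n - k) * (n * n - n * k + k * k + n + k + 1ℤ)

Recurrence : (ℕ → ℕ → ℤ) → Set
Recurrence u = ∀ n k →
  cube (1ℤ + + n) * u (suc n) k ≡ cube (1ℤ + + k) * u n (suc k) + β (+ n) (+ k) * u n k

recurrence-unique : ∀ {u v} → Recurrence u → Recurrence v → (∀ k → u 0 k ≡ v 0 k) →
                    ∀ n k → u n k ≡ v n k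
recurrence-unique ru rv u₀≡v₀ zero    k = u₀≡v₀ k
recurrence-unique {u} {v} ru rv u₀≡v₀ (suc n) k = ℤP.*-cancelˡ-≡ (cube (1ℤ + + n)) _ _ (begin
  cube (1ℤ + + n) * u (suc n) k                          ≡⟨ ru n k ⟩
  cube (1ℤ + + k) * u n (suc k) + β (+ n) (+ k) * u n k  ≡⟨ cong₂ (λ x y → cube (1ℤ + + k) * x + β (+ n) (+ k) * y)
                                                               (u≡v n (suc k)) (u≡v n k) ⟩
  cube (1ℤ + + k) * v n (suc k) + β (+ n) (+ k) * v n k  ≡⟨ rv n k ⟨
  cube (1ℤ + + n) * v (suc n) k                          ∎)
  where
  u≡v : ∀ n k → u n k ≡ v n k
  u≡v = recurrence-unique {u} {v} ru rv u₀≡v₀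

-- The inner sum at a non-negative integer n

F-term : ℕ → ℕ → ℕ → ℤ
F-term n k j = sq (binomNeg n j) * sq (binom n (k ∸ j))

F : ℕ → ℕ → ℤ
F n k = ∑ (suc k) (F-term n k)

F-witness : ℕ → ℕ → ℕ → ℤ
F-witness n k j =
  sq (+ j * binomNeg n j) * ((1ℤ + + n) * sq (binom (suc n) (suc k ∸ j)) + (+ k - + n) * sq (binom n (suc k ∸ j)))

-- In F-term-recurrence: a = D(n,j), a′ = D(n+1,j), a″ = D(n,j+1), b = C(n,i), x = C(n+1,i),
-- y = C(n,i+1), z = C(n+1,i+1) with D = binomNeg. After scaling by (1+i)² the relations express
-- everything through a and b except x, whose terms cancel; as the relations enter squared, each
-- cofactor is a multiple of u + v for the relation u ≡ v.
F-certificate : ∀ n j i k a a′ a″ b x y z .{{_ : ℤ.NonZero (1ℤ + i)}} → k ≡ j + i →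
  (1ℤ + n) * a′ ≡ (1ℤ + n + j) * a → (1ℤ + j) * a″ ≡ (1ℤ + n + j) * a →
  (1ℤ + i) * y ≡ (n - i) * b → (1ℤ + i) * z ≡ (1ℤ + n) * b →
  let W = λ j a x y → (j * a) * (j * a) * ((1ℤ + n) * (x * x) + (k - n) * (y * y)) in
  (1ℤ + n) * (1ℤ + n) * (1ℤ + n) * ((a′ * a′) * (x * x)) ≡
    (1ℤ + k) * (1ℤ + k) * (1ℤ + k) * ((a * a) * (y * y))
    + (n - k) * (n * n - n * k + k * k + n + k + 1ℤ) * ((a * a) * (b * b))
    + (W (1ℤ + j) a″ x b - W j a z y)
F-certificate n j i _ a a′ a″ b x y z refl h₁ h₂ h₃ h₄ = ℤP.i-j≡0⇒i≡j _ _
  (*≡0⇒≡0 (1ℤ + i) (*≡0⇒≡0 (1ℤ + i) (vanishes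
    ( (1ℤ + i) * (1ℤ + i) * (1ℤ + n) * (x * x) * ((1ℤ + n) * a′ + (1ℤ + n + j) * a) · h₁
    ∷ ℤ.- ((1ℤ + i) * (1ℤ + i) * ((1ℤ + n) * (x * x) + (j + i - n) * (b * b))
           * ((1ℤ + j) * a″ + (1ℤ + n + j) * a)) · h₂
    ∷ ℤ.- (((1ℤ + j + i) * (1ℤ + j + i) * (1ℤ + j + i) - j * j * (j + i - n)) * (a * a)
           * ((1ℤ + i) * y + (n - i) * b)) · h₃
    ∷ j * j * (a * a) * (1ℤ + n) * ((1ℤ + i) * z + (1ℤ + n) * b) · h₄
    ∷ [])
    (solve (n ∷ j ∷ i ∷ a ∷ a′ ∷ a″ ∷ b ∷ x ∷ y ∷ z ∷ [])))))

F-term-recurrence : ∀ n k j → j ℕ.≤ k →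
  cube (1ℤ + + n) * F-term (suc n) k j ≡
    cube (1ℤ + + k) * F-term n (suc k) j + β (+ n) (+ k) * F-term n k j + (F-witness n k (suc j) - F-witness n k j)
F-term-recurrence n k j j≤k =
  F-certificate (+ n) (+ j) (+ i) (+ k) (binomNeg n j) (binomNeg (suc n) j) (binomNeg n (suc j))
                (binom n i) (binom (suc n) i) (binom n (suc k ∸ j)) (binom (suc n) (suc k ∸ j))
                (cong +_ (sym (ℕP.m+[n∸m]≡n j≤k)))
                (binomNeg-row n j) (binomNeg-step n j)
                (trans (cong ((1ℤ + + i) *_) (shift n)) (binom-step n i))
                (trans (cong ((1ℤ + + i) *_) (shift (suc n))) (binom-absorb n i))
  where
  i : ℕ
  i = k ∸ j
  shift : ∀ m → binom m (suc k ∸ j) ≡ binom m (suc i)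
  shift m = cong (binom m) (ℕP.+-∸-assoc 1 j≤k)

F-witness-top : ∀ n k → F-witness n k (suc k) ≡ cube (1ℤ + + k) * F-term n (suc k) (suc k)
F-witness-top n k = begin
  F-witness n k (suc k)
    ≡⟨ cong₂ (λ x y → sq (+ suc k * a) * ((1ℤ + + n) * sq x + (+ k - + n) * sq y)) (one (suc n)) (one n) ⟩
  sq (+ suc k * a) * ((1ℤ + + n) * sq 1ℤ + (+ k - + n) * sq 1ℤ)
    ≡⟨ top (+ n) (+ k) a ⟩
  cube (1ℤ + + k) * (sq a * sq 1ℤ)
    ≡⟨ cong (λ y → cube (1ℤ + + k) * (sq a * sq y)) (one n) ⟨
  cube (1ℤ + + k) * F-term n (suc k) (suc k) ∎
  where
  a : ℤ
  a = binomNeg n (suc k)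
  one : ∀ m → binom m (k ∸ k) ≡ 1ℤ
  one m = trans (cong (binom m) (ℕP.n∸n≡0 k)) (binom-zero m)
  top : ∀ n k a → ((1ℤ + k) * a) * ((1ℤ + k) * a) * ((1ℤ + n) * (1ℤ * 1ℤ) + (k - n) * (1ℤ * 1ℤ)) ≡
                  (1ℤ + k) * (1ℤ + k) * (1ℤ + k) * ((a * a) * (1ℤ * 1ℤ))
  top = solve-∀

F-recurrence : Recurrence F
F-recurrence n k = begin
  cube (1ℤ + + n) * F (suc n) k
    ≡⟨ ∑-recurrence (suc k) (cube (1ℤ + + n)) K B (F-term (suc n) k) (F-term n (suc k)) (F-term n k) (F-witness n k)
         (λ j j<1+k → F-term-recurrence n k j (ℕP.≤-pred j<1+k)) ⟩
  K * S + B * F n k + (F-witness n k (suc k) - 0ℤ)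
    ≡⟨ cong (λ w → K * S + B * F n k + (w - 0ℤ)) (F-witness-top n k) ⟩
  K * S + B * F n k + (K * F-term n (suc k) (suc k) - 0ℤ)
    ≡⟨ regroup K S B (F n k) (F-term n (suc k) (suc k)) ⟩
  K * F n (suc k) + B * F n k ∎
  where
  K B S : ℤ
  K = cube (1ℤ + + k)
  B = β (+ n) (+ k)
  S = ∑ (suc k) (F-term n (suc k))
  regroup : ∀ K S B T t → K * S + B * T + (K * t - 0ℤ) ≡ K * (S + t) + B * T
  regroup = solve-∀

F-origin : ∀ k → F 0 k ≡ 1ℤ
F-origin k = cong₂ _+_ (∑-zero k below-diagonal) diagonal
  where
  below-diagonal : ∀ j → j ℕ.< k → F-term 0 k j ≡ 0ℤ
  below-diagonal j j<k = trans (cong (λ c → sq (binomNeg 0 j) * sq c) (binom-vanish (ℕP.m<n⇒0<n∸m j<k)))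
                               (ℤP.*-zeroʳ (sq (binomNeg 0 j)))
  diagonal : F-term 0 k k ≡ 1ℤ
  diagonal = cong₂ (λ a b → sq a * sq b) (binomNeg-origin k)
                   (trans (cong (binom 0) (ℕP.n∸n≡0 k)) (binom-zero 0))

-- The other side of the summation identity

binomProd : ℕ → ℕ → ℤ
binomProd n m = binom n m * binomNeg n m

binomProd-zero : ∀ n → binomProd n 0 ≡ 1ℤ
binomProd-zero n = cong₂ _*_ (binom-zero n) (binomNeg-zero n)

multiply-relations : ∀ s c d c′ d′ p q → s * c′ ≡ p * c → s * d′ ≡ q * d → s * (s * (c′ * d′)) ≡ p * q * (c * d)
multiply-relations s c d c′ d′ p q h₁ h₂ = begin
  s * (s * (c′ * d′))  ≡⟨ solve (s ∷ c′ ∷ d′ ∷ []) ⟩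
  (s * c′) * (s * d′)  ≡⟨ cong₂ _*_ h₁ h₂ ⟩
  (p * c) * (q * d)    ≡⟨ solve (p ∷ q ∷ c ∷ d ∷ []) ⟩
  p * q * (c * d)      ∎

binomProd-step : ∀ k p → (1ℤ + + p) * ((1ℤ + + p) * binomProd k (suc p)) ≡ (+ k - + p) * (1ℤ + + k + + p) * binomProd k p
binomProd-step k p = multiply-relations (1ℤ + + p) (binom k p) (binomNeg k p) (binom k (suc p)) (binomNeg k (suc p))
  (+ k - + p) (1ℤ + + k + + p) (binom-step k p) (binomNeg-step k p)

binomProd-diag : ∀ n p → (1ℤ + + p) * ((1ℤ + + p) * binomProd (suc n) (suc p)) ≡
                        (1ℤ + (1ℤ + + n) + + p) * (1ℤ + + n + + p) * binomProd n p
binomProd-diag n p = trans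
  (multiply-relations (1ℤ + + p) (binom n p) (binomNeg (suc n) p) (binom (suc n) (suc p)) (binomNeg (suc n) (suc p))
    (1ℤ + + n) (1ℤ + + suc n + + p) (binom-absorb n p) (binomNeg-step (suc n) p))
  (substitute (1ℤ + + n) (1ℤ + + suc n + + p) (binom n p) (binomNeg (suc n) p) (1ℤ + + n + + p) (binomNeg n p)
    (binomNeg-row n p))
  where
  substitute : ∀ α e c d′ γ d → α * d′ ≡ γ * d → α * e * (c * d′) ≡ e * γ * (c * d)
  substitute α e c d′ γ d h = begin
    α * e * (c * d′)  ≡⟨ solve (α ∷ e ∷ c ∷ d′ ∷ []) ⟩
    e * c * (α * d′)  ≡⟨ cong (e * c *_) h ⟩
    e * c * (γ * d)   ≡⟨ solve (e ∷ c ∷ γ ∷ d ∷ []) ⟩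
    e * γ * (c * d)   ∎

G-term : ℕ → ℕ → ℕ → ℤ
G-term n k m = binomProd k m * binomProd n m

G : ℕ → ℕ → ℤ
G n k = ∑ (suc k) (G-term n k)

G-witness : ℕ → ℕ → ℕ → ℤ
G-witness n k zero    = 0ℤ
G-witness n k (suc m) = + 2 * (+ n - + k) * (1ℤ + + k + + m) * (1ℤ + + n + + m) * G-term n k m

-- In G-term-recurrence: e = b(k,p), f = b(n,p), e′ = b(k,p+1), f′ = b(n,p+1), g = b(n+1,p+1),
-- h = b(k+1,p+1) with b = binomProd. The cofactors come from u u′ - v v′ = u (u′ - v′) + v′ (u - v).
G-certificate : ∀ n k p e f e′ f′ g h .{{_ : ℤ.NonZero (1ℤ + p)}} →
  (1ℤ + p) * ((1ℤ + p) * e′) ≡ (k - p) * (1ℤ + k + p) * e →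
  (1ℤ + p) * ((1ℤ + p) * f′) ≡ (n - p) * (1ℤ + n + p) * f →
  (1ℤ + p) * ((1ℤ + p) * g) ≡ (1ℤ + (1ℤ + n) + p) * (1ℤ + n + p) * f →
  (1ℤ + p) * ((1ℤ + p) * h) ≡ (1ℤ + (1ℤ + k) + p) * (1ℤ + k + p) * e →
  (1ℤ + n) * (1ℤ + n) * (1ℤ + n) * (e′ * g) ≡
    (1ℤ + k) * (1ℤ + k) * (1ℤ + k) * (h * f′)
    + (n - k) * (n * n - n * k + k * k + n + k + 1ℤ) * (e′ * f′)
    + (+ 2 * (n - k) * (1ℤ + k + (1ℤ + p)) * (1ℤ + n + (1ℤ + p)) * (e′ * f′)
       - + 2 * (n - k) * (1ℤ + k + p) * (1ℤ + n + p) * (e * f))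
G-certificate n k p e f e′ f′ g h h₁ h₂ h₃ h₄ = ℤP.i-j≡0⇒i≡j _ _
  (*≡0⇒≡0 (1ℤ + p) (*≡0⇒≡0 (1ℤ + p) (*≡0⇒≡0 (1ℤ + p) (*≡0⇒≡0 (1ℤ + p) (vanishes
    ( (1ℤ + n) * (1ℤ + n) * (1ℤ + n) * ((1ℤ + (1ℤ + n) + p) * (1ℤ + n + p) * f)
      - ((n - k) * (n * n - n * k + k * k + n + k + 1ℤ) + + 2 * (n - k) * (1ℤ + k + (1ℤ + p)) * (1ℤ + n + (1ℤ + p)))
        * ((n - p) * (1ℤ + n + p) * f) · h₁
    ∷ ℤ.- ((1ℤ + k) * (1ℤ + k) * (1ℤ + k) * ((1ℤ + p) * ((1ℤ + p) * h))
           + ((n - k) * (n * n - n * k + k * k + n + k + 1ℤ) + + 2 * (n - k) * (1ℤ + k + (1ℤ + p)) * (1ℤ + n + (1ℤ + p)))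
             * ((1ℤ + p) * ((1ℤ + p) * e′))) · h₂
    ∷ (1ℤ + n) * (1ℤ + n) * (1ℤ + n) * ((1ℤ + p) * ((1ℤ + p) * e′)) · h₃
    ∷ ℤ.- ((1ℤ + k) * (1ℤ + k) * (1ℤ + k) * ((n - p) * (1ℤ + n + p) * f)) · h₄
    ∷ [])
    (solve (n ∷ k ∷ p ∷ e ∷ f ∷ e′ ∷ f′ ∷ g ∷ h ∷ [])))))))

G-term-recurrence : ∀ n k m →
  cube (1ℤ + + n) * G-term (suc n) k m ≡
    cube (1ℤ + + k) * G-term n (suc k) m + β (+ n) (+ k) * G-term n k m + (G-witness n k (suc m) - G-witness n k m)
G-term-recurrence n k zero = begin
  cube (1ℤ + + n) * G-term (suc n) k 0
    ≡⟨ cong (cube (1ℤ + + n) *_) (G-term-zero (suc n) k) ⟩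
  cube (1ℤ + + n) * 1ℤ
    ≡⟨ base (+ n) (+ k) ⟩
  cube (1ℤ + + k) * 1ℤ + β (+ n) (+ k) * 1ℤ + (+ 2 * (+ n - + k) * (1ℤ + + k + + 0) * (1ℤ + + n + + 0) * 1ℤ - 0ℤ)
    ≡⟨ cong₂ (λ t u → cube (1ℤ + + k) * t + β (+ n) (+ k) * u
                      + (+ 2 * (+ n - + k) * (1ℤ + + k + + 0) * (1ℤ + + n + + 0) * u - 0ℤ))
             (G-term-zero n (suc k)) (G-term-zero n k) ⟨
  cube (1ℤ + + k) * G-term n (suc k) 0 + β (+ n) (+ k) * G-term n k 0 + (G-witness n k 1 - G-witness n k 0) ∎
  where
  G-term-zero : ∀ n k → G-term n k 0 ≡ 1ℤ
  G-term-zero n k = cong₂ _*_ (binomProd-zero k) (binomProd-zero n)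
  base : ∀ n k → (1ℤ + n) * (1ℤ + n) * (1ℤ + n) * 1ℤ ≡
    (1ℤ + k) * (1ℤ + k) * (1ℤ + k) * 1ℤ + (n - k) * (n * n - n * k + k * k + n + k + 1ℤ) * 1ℤ
    + (+ 2 * (n - k) * (1ℤ + k + + 0) * (1ℤ + n + + 0) * 1ℤ - 0ℤ)
  base = solve-∀
G-term-recurrence n k (suc p) =
  G-certificate (+ n) (+ k) (+ p) (binomProd k p) (binomProd n p) (binomProd k (suc p)) (binomProd n (suc p))
                (binomProd (suc n) (suc p)) (binomProd (suc k) (suc p))
                (binomProd-step k p) (binomProd-step n p) (binomProd-diag n p) (binomProd-diag k p)

G-term-vanish : ∀ n {k m} → k ℕ.< m → G-term n k m ≡ 0ℤ
G-term-vanish n {k} {m} k<m = cong (λ c → c * binomNeg k m * binomProd n m) (binom-vanish k<m)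

G-recurrence : Recurrence G
G-recurrence n k = begin
  cube (1ℤ + + n) * G (suc n) k
    ≡⟨ cong (cube (1ℤ + + n) *_) (∑-pad (λ m → G-term-vanish (suc n)) (ℕP.n≤1+n (suc k))) ⟨
  cube (1ℤ + + n) * ∑ (suc (suc k)) (G-term (suc n) k)
    ≡⟨ ∑-recurrence (suc (suc k)) (cube (1ℤ + + n)) K B (G-term (suc n) k) (G-term n (suc k)) (G-term n k) (G-witness n k)
         (λ m _ → G-term-recurrence n k m) ⟩
  K * G n (suc k) + B * (G n k + G-term n k (suc k)) + (G-witness n k (suc (suc k)) - 0ℤ)
    ≡⟨ cong₂ (λ t w → K * G n (suc k) + B * (G n k + t) + (w - 0ℤ)) top witness-top ⟩
  K * G n (suc k) + B * (G n k + 0ℤ) + (0ℤ - 0ℤ)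
    ≡⟨ drop-zeros (K * G n (suc k)) B (G n k) ⟩
  K * G n (suc k) + B * G n k ∎
  where
  K B : ℤ
  K = cube (1ℤ + + k)
  B = β (+ n) (+ k)
  top : G-term n k (suc k) ≡ 0ℤ
  top = G-term-vanish n (ℕP.n<1+n k)
  witness-top : G-witness n k (suc (suc k)) ≡ 0ℤ
  witness-top = trans (cong (c *_) top) (ℤP.*-zeroʳ c)
    where
    c : ℤ
    c = + 2 * (+ n - + k) * (1ℤ + + k + + suc k) * (1ℤ + + n + + suc k)
  drop-zeros : ∀ x B T → x + B * (T + 0ℤ) + (0ℤ - 0ℤ) ≡ x + B * T
  drop-zeros = solve-∀

G-origin : ∀ k → G 0 k ≡ 1ℤ
G-origin k = begin
  G 0 k                                              ≡⟨ ∑-suc k (G-term 0 k) ⟩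
  G-term 0 k 0 + ∑ k (λ m → G-term 0 k (suc m))      ≡⟨ cong₂ _+_ (cong₂ _*_ (binomProd-zero k) (binomProd-zero 0))
                                                                    (∑-zero k (λ m _ → ℤP.*-zeroʳ (binomProd k (suc m)))) ⟩
  1ℤ ∎

F≡G : ∀ n k → F n k ≡ G n k
F≡G = recurrence-unique {F} {G} F-recurrence G-recurrence (λ k → trans (F-origin k) (sym (G-origin k)))

-- Divisibility of the weighted sums

odd : ℕ → ℤ
odd k = + (2 ℕ.* k ℕ.+ 1)

odd≡ : ∀ k → odd k ≡ + 2 * + k + 1ℤ
odd≡ k = cong (_+ 1ℤ) (ℤP.pos-* 2 k)

weightedSum : ℤ → ℕ → ℕ → ℕ → ℤ
weightedSum ε E n m = ∑ n (λ k → ε ^ k * odd k ^ E * binomProd k m)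

odd²*binomProd : ∀ k m →
  sq (odd k) * binomProd k m ≡ + 4 * sq (1ℤ + + m) * binomProd k (suc m) + sq (odd m) * binomProd k m
odd²*binomProd k m =
  step (+ k) (+ m) (odd k) (odd m) (binomProd k m) (binomProd k (suc m)) (odd≡ k) (odd≡ m) (binomProd-step k m)
  where
  step : ∀ k m o o′ b b′ → o ≡ + 2 * k + 1ℤ → o′ ≡ + 2 * m + 1ℤ →
         (1ℤ + m) * ((1ℤ + m) * b′) ≡ (k - m) * (1ℤ + k + m) * b →
         o * o * b ≡ + 4 * ((1ℤ + m) * (1ℤ + m)) * b′ + o′ * o′ * b
  step k m _ _ b b′ refl refl h = begin
    (+ 2 * k + 1ℤ) * (+ 2 * k + 1ℤ) * b
      ≡⟨ solve (k ∷ m ∷ b ∷ []) ⟩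
    + 4 * ((k - m) * (1ℤ + k + m) * b) + (+ 2 * m + 1ℤ) * (+ 2 * m + 1ℤ) * b
      ≡⟨ cong (λ t → + 4 * t + (+ 2 * m + 1ℤ) * (+ 2 * m + 1ℤ) * b) h ⟨
    + 4 * ((1ℤ + m) * ((1ℤ + m) * b′)) + (+ 2 * m + 1ℤ) * (+ 2 * m + 1ℤ) * b
      ≡⟨ solve (m ∷ b ∷ b′ ∷ []) ⟩
    + 4 * ((1ℤ + m) * (1ℤ + m)) * b′ + (+ 2 * m + 1ℤ) * (+ 2 * m + 1ℤ) * b ∎

weightedSum-step : ∀ ε E n m → weightedSum ε (suc (suc E)) n m ≡
  + 4 * sq (1ℤ + + m) * weightedSum ε E n (suc m) + sq (odd m) * weightedSum ε E n m
weightedSum-step ε E n m = trans (∑-cong n (λ k _ → termwise k))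
  (∑-linear n (+ 4 * sq (1ℤ + + m)) (sq (odd m))
    (λ k → ε ^ k * odd k ^ E * binomProd k (suc m)) (λ k → ε ^ k * odd k ^ E * binomProd k m))
  where
  distribute : ∀ σ p o b b′ c₁ c₂ → o * o * b ≡ c₁ * b′ + c₂ * b →
               σ * (o * (o * p)) * b ≡ c₁ * (σ * p * b′) + c₂ * (σ * p * b)
  distribute σ p o b b′ c₁ c₂ h = begin
    σ * (o * (o * p)) * b       ≡⟨ solve (σ ∷ p ∷ o ∷ b ∷ []) ⟩
    σ * p * (o * o * b)         ≡⟨ cong (σ * p *_) h ⟩
    σ * p * (c₁ * b′ + c₂ * b)  ≡⟨ solve (σ ∷ p ∷ b ∷ b′ ∷ c₁ ∷ c₂ ∷ []) ⟩
    c₁ * (σ * p * b′) + c₂ * (σ * p * b) ∎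
  termwise : ∀ k → ε ^ k * odd k ^ suc (suc E) * binomProd k m ≡
    + 4 * sq (1ℤ + + m) * (ε ^ k * odd k ^ E * binomProd k (suc m)) + sq (odd m) * (ε ^ k * odd k ^ E * binomProd k m)
  termwise k = distribute (ε ^ k) (odd k ^ E) (odd k) (binomProd k m) (binomProd k (suc m))
                          (+ 4 * sq (1ℤ + + m)) (sq (odd m)) (odd²*binomProd k m)

weightedSum-plus : ∀ n m → weightedSum 1ℤ 1 n m ≡ + n * (binom n (suc m) * binomNeg n m)
weightedSum-plus zero    m = refl
weightedSum-plus (suc n) m = begin
  weightedSum 1ℤ 1 n m + 1ℤ ^ n * odd n ^ 1 * binomProd n m
    ≡⟨ cong₂ _+_ (weightedSum-plus n m) (cong (λ σ → σ * odd n ^ 1 * binomProd n m) (ℤP.^-zeroˡ n)) ⟩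
  + n * (binom n (suc m) * binomNeg n m) + 1ℤ * odd n ^ 1 * binomProd n m
    ≡⟨ step (+ n) (+ m) (binom n m) (binom n (suc m)) (binomNeg n m) (binomNeg (suc n) m) (odd n) _
         (odd≡ n) (binom-pascal n m) (binomNeg-row n m) (binom-step n m) ⟩
  + suc n * (binom (suc n) (suc m) * binomNeg (suc n) m) ∎
  where
  step : ∀ n m c₀ c₁ d₀ d₁ o c → o ≡ + 2 * n + 1ℤ → c ≡ c₀ + c₁ →
    (1ℤ + n) * d₁ ≡ (1ℤ + n + m) * d₀ → (1ℤ + m) * c₁ ≡ (n - m) * c₀ →
    n * (c₁ * d₀) + 1ℤ * (o * 1ℤ) * (c₀ * d₀) ≡ (1ℤ + n) * (c * d₁)
  step n m c₀ c₁ d₀ d₁ _ _ refl refl h₁ h₂ = ℤP.i-j≡0⇒i≡j _ _ (vanishes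
    (ℤ.- (c₀ + c₁) · h₁ ∷ ℤ.- d₀ · h₂ ∷ [])
    (solve (n ∷ m ∷ c₀ ∷ c₁ ∷ d₀ ∷ d₁ ∷ [])))

weightedSum-minus : ∀ n m → weightedSum -1ℤ 1 (suc n) m ≡ + suc n * (-1ℤ ^ n * binom n m * binomNeg (suc n) m)
weightedSum-minus zero zero    = refl
weightedSum-minus zero (suc m) = refl
weightedSum-minus (suc n) m = begin
  weightedSum -1ℤ 1 (suc n) m + -1ℤ ^ suc n * odd (suc n) ^ 1 * binomProd (suc n) m
    ≡⟨ cong (_+ -1ℤ ^ suc n * odd (suc n) ^ 1 * binomProd (suc n) m) (weightedSum-minus n m) ⟩
  + suc n * (-1ℤ ^ n * binom n m * binomNeg (suc n) m) + -1ℤ ^ suc n * odd (suc n) ^ 1 * binomProd (suc n) m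
    ≡⟨ step (+ n) (+ m) (-1ℤ ^ n) (binom n m) (binom (suc n) m) (binomNeg (suc n) m) (binomNeg (suc (suc n)) m)
         (odd (suc n)) (odd≡ (suc n)) (binom-row n m) (binomNeg-row (suc n) m) ⟩
  + suc (suc n) * (-1ℤ ^ suc n * binom (suc n) m * binomNeg (suc (suc n)) m) ∎
  where
  step : ∀ n m σ c₀ c₁ d₁ d₂ o → o ≡ + 2 * (1ℤ + n) + 1ℤ →
    (1ℤ + n - m) * c₁ ≡ (1ℤ + n) * c₀ → (1ℤ + (1ℤ + n)) * d₂ ≡ (1ℤ + (1ℤ + n) + m) * d₁ →
    (1ℤ + n) * (σ * c₀ * d₁) + -1ℤ * σ * (o * 1ℤ) * (c₁ * d₁) ≡ (1ℤ + (1ℤ + n)) * (-1ℤ * σ * c₁ * d₂)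
  step n m σ c₀ c₁ d₁ d₂ _ refl h₁ h₂ = ℤP.i-j≡0⇒i≡j _ _ (vanishes
    (ℤ.- (σ * d₁) · h₁ ∷ σ * c₁ · h₂ ∷ [])
    (solve (n ∷ m ∷ σ ∷ c₀ ∷ c₁ ∷ d₁ ∷ d₂ ∷ [])))

weightedSum-divisible : ∀ {ε} → ε ≡ 1ℤ ⊎ ε ≡ -1ℤ → ∀ n l m → + n ∣ weightedSum ε (suc (2 ℕ.* l)) n m
weightedSum-divisible (inj₁ refl) n zero m =
  divides (binom n (suc m) * binomNeg n m) (trans (weightedSum-plus n m) (ℤP.*-comm (+ n) _))
weightedSum-divisible (inj₂ refl) zero zero m = divides 0ℤ refl
weightedSum-divisible (inj₂ refl) (suc n) zero m =
  divides (-1ℤ ^ n * binom n m * binomNeg (suc n) m) (trans (weightedSum-minus n m) (ℤP.*-comm (+ suc n) _))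
weightedSum-divisible {ε} ε≡±1 n (suc l) m =
  subst (λ E → + n ∣ weightedSum ε E n m) (cong suc (sym (ℕP.*-suc 2 l)))
    (subst (+ n ∣_) (sym (weightedSum-step ε (suc (2 ℕ.* l)) n m))
      (∣m∣n⇒∣m+n (∣n⇒∣m*n (+ 4 * sq (1ℤ + + m)) (weightedSum-divisible ε≡±1 n l (suc m)))
                 (∣n⇒∣m*n (sq (odd m)) (weightedSum-divisible ε≡±1 n l m))))

∑-F≡∑-weightedSum : ∀ ε E n N →
  ∑ n (λ k → ε ^ k * odd k ^ E * F N k) ≡ ∑ n (λ m → binomProd N m * weightedSum ε E n m)
∑-F≡∑-weightedSum ε E n N = begin
  ∑ n (λ k → c k * F N k)
    ≡⟨ ∑-cong n (λ k k<n → cong (c k *_) (trans (F≡G N k) (sym (∑-pad (λ m → G-term-vanish N) k<n)))) ⟩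
  ∑ n (λ k → c k * ∑ n (G-term N k))
    ≡⟨ ∑-cong n (λ k _ → *-distribˡ-∑ n (c k) (G-term N k)) ⟩
  ∑ n (λ k → ∑ n (λ m → c k * G-term N k m))
    ≡⟨ ∑-cong n (λ k _ → ∑-cong n (λ m _ → regroup (c k) (binomProd k m) (binomProd N m))) ⟩
  ∑ n (λ k → ∑ n (λ m → binomProd N m * (c k * binomProd k m)))
    ≡⟨ ∑-comm n n (λ k m → binomProd N m * (c k * binomProd k m)) ⟩
  ∑ n (λ m → ∑ n (λ k → binomProd N m * (c k * binomProd k m)))
    ≡⟨ ∑-cong n (λ m _ → *-distribˡ-∑ n (binomProd N m) (λ k → c k * binomProd k m)) ⟨
  ∑ n (λ m → binomProd N m * weightedSum ε E n m) ∎
  where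
  c : ℕ → ℤ
  c k = ε ^ k * odd k ^ E
  regroup : ∀ c b b′ → c * (b * b′) ≡ b′ * (c * b)
  regroup = solve-∀

∑-F-divisible : ∀ {ε} → ε ≡ 1ℤ ⊎ ε ≡ -1ℤ → ∀ n l N → + n ∣ ∑ n (λ k → ε ^ k * odd k ^ suc (2 ℕ.* l) * F N k)
∑-F-divisible {ε} ε≡±1 n l N = subst (+ n ∣_) (sym (∑-F≡∑-weightedSum ε (suc (2 ℕ.* l)) n N))
  (∣-∑ n (λ m → ∣n⇒∣m*n (binomProd N m) (weightedSum-divisible ε≡±1 n l m)))

ℤtoℚ≡mkℚ : ∀ a → ℤtoℚ a ≡ mkℚ a 0 (Coprimality.sym (Coprimality.1-coprimeTo _))
ℤtoℚ≡mkℚ a = ℚP.↥p/↧p≡p (mkℚ a 0 (Coprimality.sym (Coprimality.1-coprimeTo _)))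

ℤtoℚ-+ : ∀ a b → ℤtoℚ (a + b) ≡ ℤtoℚ a ℚ.+ ℤtoℚ b
ℤtoℚ-+ a b rewrite ℤtoℚ≡mkℚ a | ℤtoℚ≡mkℚ b =
  cong (λ t → t ℚ./ 1) (cong₂ _+_ (sym (ℤP.*-identityʳ a)) (sym (ℤP.*-identityʳ b)))

ℤtoℚ-* : ∀ a b → ℤtoℚ (a * b) ≡ ℤtoℚ a ℚ.* ℤtoℚ b
ℤtoℚ-* a b rewrite ℤtoℚ≡mkℚ a | ℤtoℚ≡mkℚ b = refl

ℤtoℚ-neg : ∀ a → ℤtoℚ (ℤ.- a) ≡ - ℤtoℚ a
ℤtoℚ-neg (+ zero)  = refl
ℤtoℚ-neg (+ suc n) = trans (ℤtoℚ≡mkℚ -[1+ n ]) (cong -_ (sym (ℤtoℚ≡mkℚ (+ suc n))))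
ℤtoℚ-neg -[1+ n ]  = trans (ℤtoℚ≡mkℚ (+ suc n)) (cong -_ (sym (ℤtoℚ≡mkℚ -[1+ n ])))

ℤtoℚ-- : ∀ a b → ℤtoℚ (a - b) ≡ ℤtoℚ a ℚ.- ℤtoℚ b
ℤtoℚ-- a b = trans (ℤtoℚ-+ a (ℤ.- b)) (cong (ℤtoℚ a ℚ.+_) (ℤtoℚ-neg b))

ℤtoℚ-*-/ : ∀ c n → ℤtoℚ (c * + suc n) ℚ.* (+ 1 ℚ./ suc n) ≡ ℤtoℚ c
ℤtoℚ-*-/ c n = begin
  ℤtoℚ (c * + suc n) ℚ.* w         ≡⟨ cong (ℚ._* w) (ℤtoℚ-* c (+ suc n)) ⟩
  ℤtoℚ c ℚ.* ℤtoℚ (+ suc n) ℚ.* w  ≡⟨ ℚP.*-assoc (ℤtoℚ c) (ℤtoℚ (+ suc n)) w ⟩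
  ℤtoℚ c ℚ.* (ℤtoℚ (+ suc n) ℚ.* w) ≡⟨ cong (ℤtoℚ c ℚ.*_) inverse ⟩
  ℤtoℚ c ℚ.* 1ℚ                    ≡⟨ ℚP.*-identityʳ (ℤtoℚ c) ⟩
  ℤtoℚ c                           ∎
  where
  w : ℚ
  w = + 1 ℚ./ suc n
  inverse : ℤtoℚ (+ suc n) ℚ.* w ≡ 1ℚ
  inverse rewrite ℤtoℚ≡mkℚ (+ suc n) | ℚP.normalize-coprime {1} {n} (Coprimality.1-coprimeTo (suc n)) =
    ℚP.*-inverseʳ (mkℚ (+ suc n) 0 (Coprimality.sym (Coprimality.1-coprimeTo _)))

pow-ℤtoℚ : ∀ a k → pow (ℤtoℚ a) k ≡ ℤtoℚ (a ^ k)
pow-ℤtoℚ a zero    = refl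
pow-ℤtoℚ a (suc k) = begin
  pow (ℤtoℚ a) k ℚ.* ℤtoℚ a  ≡⟨ cong (ℚ._* ℤtoℚ a) (pow-ℤtoℚ a k) ⟩
  ℤtoℚ (a ^ k) ℚ.* ℤtoℚ a    ≡⟨ ℤtoℚ-* (a ^ k) a ⟨
  ℤtoℚ (a ^ k * a)           ≡⟨ cong ℤtoℚ (ℤP.*-comm (a ^ k) a) ⟩
  ℤtoℚ (a * a ^ k)           ∎

squares-ℤtoℚ : ∀ a b → pow (ℤtoℚ a) 2 ℚ.* pow (ℤtoℚ b) 2 ≡ ℤtoℚ (sq a * sq b)
squares-ℤtoℚ a b = begin
  pow (ℤtoℚ a) 2 ℚ.* pow (ℤtoℚ b) 2  ≡⟨ cong₂ ℚ._*_ (pow-ℤtoℚ a 2) (pow-ℤtoℚ b 2) ⟩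
  ℤtoℚ (a ^ 2) ℚ.* ℤtoℚ (b ^ 2)      ≡⟨ ℤtoℚ-* (a ^ 2) (b ^ 2) ⟨
  ℤtoℚ (a ^ 2 * b ^ 2)               ≡⟨ cong ℤtoℚ (cong₂ _*_ (square a) (square b)) ⟩
  ℤtoℚ (sq a * sq b)                 ∎
  where
  square : ∀ a → a ^ 2 ≡ sq a
  square a = cong (a *_) (ℤP.*-identityʳ a)

sumTo-cong : ∀ n {f g : ℕ → ℚ} → (∀ k → k ℕ.< n → f k ≡ g k) → sumTo n f ≡ sumTo n g
sumTo-cong zero    f≡g = refl
sumTo-cong (suc n) f≡g = cong₂ ℚ._+_ (sumTo-cong n (λ k k<n → f≡g k (ℕP.m<n⇒m<1+n k<n))) (f≡g n (ℕP.n<1+n n))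

sumTo-ℤtoℚ : ∀ n (f : ℕ → ℤ) → sumTo n (λ k → ℤtoℚ (f k)) ≡ ℤtoℚ (∑ n f)
sumTo-ℤtoℚ zero    f = refl
sumTo-ℤtoℚ (suc n) f = trans (cong (ℚ._+ ℤtoℚ (f n)) (sumTo-ℤtoℚ n f)) (sym (ℤtoℚ-+ (∑ n f) (f n)))

choose-pos : ∀ N i → choose (ℤtoℚ (+ N)) i ≡ ℤtoℚ (binom N i)
choose-pos N zero    = cong ℤtoℚ (sym (binom-zero N))
choose-pos N (suc i) = begin
  choose (ℤtoℚ (+ N)) i ℚ.* (ℤtoℚ (+ N) ℚ.- ℤtoℚ (+ i)) ℚ.* w
    ≡⟨ cong (λ t → t ℚ.* (ℤtoℚ (+ N) ℚ.- ℤtoℚ (+ i)) ℚ.* w) (choose-pos N i) ⟩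
  ℤtoℚ (binom N i) ℚ.* (ℤtoℚ (+ N) ℚ.- ℤtoℚ (+ i)) ℚ.* w
    ≡⟨ cong (λ t → ℤtoℚ (binom N i) ℚ.* t ℚ.* w) (ℤtoℚ-- (+ N) (+ i)) ⟨
  ℤtoℚ (binom N i) ℚ.* ℤtoℚ (+ N - + i) ℚ.* w
    ≡⟨ cong (ℚ._* w) (ℤtoℚ-* (binom N i) (+ N - + i)) ⟨
  ℤtoℚ (binom N i * (+ N - + i)) ℚ.* w
    ≡⟨ cong (λ t → ℤtoℚ t ℚ.* w) (trans (ℤP.*-comm (binom N i) (+ N - + i))
                                  (trans (sym (binom-step N i)) (ℤP.*-comm (+ suc i) (binom N (suc i))))) ⟩
  ℤtoℚ (binom N (suc i) * + suc i) ℚ.* w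
    ≡⟨ ℤtoℚ-*-/ (binom N (suc i)) i ⟩
  ℤtoℚ (binom N (suc i)) ∎
  where
  w : ℚ
  w = + 1 ℚ./ suc i

choose-neg : ∀ N j → choose (ℤtoℚ -[1+ N ]) j ≡ ℤtoℚ (-1ℤ ^ j * binomNeg N j)
choose-neg N zero    = cong ℤtoℚ (sym (trans (ℤP.*-identityˡ (binomNeg N 0)) (binomNeg-zero N)))
choose-neg N (suc j) = begin
  choose (ℤtoℚ -[1+ N ]) j ℚ.* (ℤtoℚ -[1+ N ] ℚ.- ℤtoℚ (+ j)) ℚ.* w
    ≡⟨ cong (λ t → t ℚ.* (ℤtoℚ -[1+ N ] ℚ.- ℤtoℚ (+ j)) ℚ.* w) (choose-neg N j) ⟩
  ℤtoℚ (σ * D) ℚ.* (ℤtoℚ -[1+ N ] ℚ.- ℤtoℚ (+ j)) ℚ.* w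
    ≡⟨ cong (λ t → ℤtoℚ (σ * D) ℚ.* t ℚ.* w) (ℤtoℚ-- -[1+ N ] (+ j)) ⟨
  ℤtoℚ (σ * D) ℚ.* ℤtoℚ (-[1+ N ] - + j) ℚ.* w
    ≡⟨ cong (ℚ._* w) (ℤtoℚ-* (σ * D) (-[1+ N ] - + j)) ⟨
  ℤtoℚ (σ * D * (-[1+ N ] - + j)) ℚ.* w
    ≡⟨ cong (λ t → ℤtoℚ t ℚ.* w) (step (+ N) (+ j) σ D (binomNeg N (suc j)) (binomNeg-step N j)) ⟩
  ℤtoℚ (-1ℤ * σ * binomNeg N (suc j) * + suc j) ℚ.* w
    ≡⟨ ℤtoℚ-*-/ (-1ℤ * σ * binomNeg N (suc j)) j ⟩
  ℤtoℚ (-1ℤ * σ * binomNeg N (suc j)) ∎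
  where
  w : ℚ
  w = + 1 ℚ./ suc j
  σ D : ℤ
  σ = -1ℤ ^ j
  D = binomNeg N j
  step : ∀ n j σ d d′ → (1ℤ + j) * d′ ≡ (1ℤ + n + j) * d →
         σ * d * (ℤ.- (1ℤ + n) - j) ≡ -1ℤ * σ * d′ * (1ℤ + j)
  step n j σ d d′ h = ℤP.i-j≡0⇒i≡j _ _ (vanishes (σ · h ∷ []) (solve (n ∷ j ∷ σ ∷ d ∷ d′ ∷ [])))

sq-sign : ∀ j a → sq (-1ℤ ^ j * a) ≡ sq a
sq-sign zero    a = cong sq (ℤP.*-identityˡ a)
sq-sign (suc j) a = trans (drop-sign (-1ℤ ^ j) a) (sq-sign j a)
  where
  drop-sign : ∀ σ a → (-1ℤ * σ * a) * (-1ℤ * σ * a) ≡ (σ * a) * (σ * a)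
  drop-sign = solve-∀

innerSum : ℚ → ℕ → ℚ
innerSum x k = sumTo (suc k) (λ j → pow (choose (- x ℚ.- 1ℚ) j) 2 ℚ.* pow (choose x (k ∸ j)) 2)

innerSum≡F : ∀ x → ∃ λ N → ∀ k → innerSum (ℤtoℚ x) k ≡ ℤtoℚ (F N k)
innerSum≡F (+ N) = N , λ k → trans (sumTo-cong (suc k) (λ j _ → term k j)) (sumTo-ℤtoℚ (suc k) (F-term N k))
  where
  -x-1 : - ℤtoℚ (+ N) ℚ.- 1ℚ ≡ ℤtoℚ -[1+ N ]
  -x-1 = begin
    - ℤtoℚ (+ N) ℚ.- 1ℚ       ≡⟨ cong (ℚ._- 1ℚ) (ℤtoℚ-neg (+ N)) ⟨
    ℤtoℚ (ℤ.- + N) ℚ.- 1ℚ     ≡⟨ ℤtoℚ-- (ℤ.- + N) 1ℤ ⟨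
    ℤtoℚ (ℤ.- + N - 1ℤ)       ≡⟨ cong ℤtoℚ (ℤP.neg-distrib-+ (+ N) 1ℤ) ⟨
    ℤtoℚ (ℤ.- (+ N + 1ℤ))     ≡⟨ cong (λ m → ℤtoℚ (ℤ.- + m)) (ℕP.+-comm N 1) ⟩
    ℤtoℚ -[1+ N ]             ∎
  term : ∀ k j → pow (choose (- ℤtoℚ (+ N) ℚ.- 1ℚ) j) 2 ℚ.* pow (choose (ℤtoℚ (+ N)) (k ∸ j)) 2 ≡ ℤtoℚ (F-term N k j)
  term k j = begin
    pow (choose (- ℤtoℚ (+ N) ℚ.- 1ℚ) j) 2 ℚ.* pow (choose (ℤtoℚ (+ N)) (k ∸ j)) 2
      ≡⟨ cong₂ (λ u v → pow u 2 ℚ.* pow v 2) (trans (cong (λ t → choose t j) -x-1) (choose-neg N j)) (choose-pos N (k ∸ j)) ⟩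
    pow (ℤtoℚ (-1ℤ ^ j * binomNeg N j)) 2 ℚ.* pow (ℤtoℚ (binom N (k ∸ j))) 2
      ≡⟨ squares-ℤtoℚ (-1ℤ ^ j * binomNeg N j) (binom N (k ∸ j)) ⟩
    ℤtoℚ (sq (-1ℤ ^ j * binomNeg N j) * sq (binom N (k ∸ j)))
      ≡⟨ cong (λ t → ℤtoℚ (t * sq (binom N (k ∸ j)))) (sq-sign j (binomNeg N j)) ⟩
    ℤtoℚ (F-term N k j) ∎
innerSum≡F -[1+ M ] = M , λ k → begin
  innerSum (ℤtoℚ -[1+ M ]) k
    ≡⟨ sumTo-cong (suc k) (λ j j<1+k → term k j (ℕP.≤-pred j<1+k)) ⟩
  sumTo (suc k) (λ j → ℤtoℚ (F-term M k (k ∸ j)))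
    ≡⟨ sumTo-ℤtoℚ (suc k) (λ j → F-term M k (k ∸ j)) ⟩
  ℤtoℚ (∑ (suc k) (λ j → F-term M k (k ∸ j)))
    ≡⟨ cong ℤtoℚ (∑-reverse (suc k) (F-term M k)) ⟨
  ℤtoℚ (F M k) ∎
  where
  -x-1 : - ℤtoℚ -[1+ M ] ℚ.- 1ℚ ≡ ℤtoℚ (+ M)
  -x-1 = trans (cong (ℚ._- 1ℚ) (sym (ℤtoℚ-neg -[1+ M ]))) (sym (ℤtoℚ-- (+ suc M) 1ℤ))
  term : ∀ k j → j ℕ.≤ k →
    pow (choose (- ℤtoℚ -[1+ M ] ℚ.- 1ℚ) j) 2 ℚ.* pow (choose (ℤtoℚ -[1+ M ]) (k ∸ j)) 2 ≡ ℤtoℚ (F-term M k (k ∸ j))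
  term k j j≤k = begin
    pow (choose (- ℤtoℚ -[1+ M ] ℚ.- 1ℚ) j) 2 ℚ.* pow (choose (ℤtoℚ -[1+ M ]) (k ∸ j)) 2
      ≡⟨ cong₂ (λ u v → pow u 2 ℚ.* pow v 2) (trans (cong (λ t → choose t j) -x-1) (choose-pos M j)) (choose-neg M (k ∸ j)) ⟩
    pow (ℤtoℚ (binom M j)) 2 ℚ.* pow (ℤtoℚ (-1ℤ ^ (k ∸ j) * binomNeg M (k ∸ j))) 2
      ≡⟨ squares-ℤtoℚ (binom M j) (-1ℤ ^ (k ∸ j) * binomNeg M (k ∸ j)) ⟩
    ℤtoℚ (sq (binom M j) * sq (-1ℤ ^ (k ∸ j) * binomNeg M (k ∸ j)))
      ≡⟨ cong ℤtoℚ (trans (cong (sq (binom M j) *_) (sq-sign (k ∸ j) (binomNeg M (k ∸ j))))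
                          (ℤP.*-comm (sq (binom M j)) (sq (binomNeg M (k ∸ j))))) ⟩
    ℤtoℚ (sq (binomNeg M (k ∸ j)) * sq (binom M j))
      ≡⟨ cong (λ i → ℤtoℚ (sq (binomNeg M (k ∸ j)) * sq (binom M i))) (ℕP.m∸[m∸n]≡n j≤k) ⟨
    ℤtoℚ (F-term M k (k ∸ j)) ∎

P-at-integers : ∀ l n .{{_ : NonZero n}} e x N → (∀ k → innerSum (ℤtoℚ x) k ≡ ℤtoℚ (F N k)) →
  P l n (ℤtoℚ e) (ℤtoℚ x) ≡ (+ 1 ℚ./ n) ℚ.* ℤtoℚ (∑ n (λ k → e ^ k * odd k ^ (2 ℕ.* l ∸ 1) * F N k))
P-at-integers l n e x N inner≡F =
  cong ((+ 1 ℚ./ n) ℚ.*_) (trans (sumTo-cong n (λ k _ → summand k)) (sumTo-ℤtoℚ n (λ k → e ^ k * odd k ^ E * F N k)))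
  where
  E : ℕ
  E = 2 ℕ.* l ∸ 1
  summand : ∀ k → pow (ℤtoℚ e) k ℚ.* pow (ℤtoℚ (odd k)) E ℚ.* innerSum (ℤtoℚ x) k ≡ ℤtoℚ (e ^ k * odd k ^ E * F N k)
  summand k = begin
    pow (ℤtoℚ e) k ℚ.* pow (ℤtoℚ (odd k)) E ℚ.* innerSum (ℤtoℚ x) k
      ≡⟨ cong₂ ℚ._*_ (cong₂ ℚ._*_ (pow-ℤtoℚ e k) (pow-ℤtoℚ (odd k) E)) (inner≡F k) ⟩
    ℤtoℚ (e ^ k) ℚ.* ℤtoℚ (odd k ^ E) ℚ.* ℤtoℚ (F N k)
      ≡⟨ cong (ℚ._* ℤtoℚ (F N k)) (ℤtoℚ-* (e ^ k) (odd k ^ E)) ⟨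
    ℤtoℚ (e ^ k * odd k ^ E) ℚ.* ℤtoℚ (F N k)
      ≡⟨ ℤtoℚ-* (e ^ k * odd k ^ E) (F N k) ⟨
    ℤtoℚ (e ^ k * odd k ^ E * F N k) ∎

±1-from-ℚ : ∀ {ε} → ε ≡ 1ℚ ⊎ ε ≡ - 1ℚ → ∃ λ e → (e ≡ 1ℤ ⊎ e ≡ -1ℤ) × ℤtoℚ e ≡ ε
±1-from-ℚ (inj₁ refl) = 1ℤ , inj₁ refl , refl
±1-from-ℚ (inj₂ refl) = -1ℤ , inj₂ refl , refl

P-integral : ∀ l n {e} → e ≡ 1ℤ ⊎ e ≡ -1ℤ → ∀ x → ∃ λ z → P (suc l) (suc n) (ℤtoℚ e) (ℤtoℚ x) ≡ ℤtoℚ z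
P-integral l n {e} e≡±1 x = quotient n∣∑ , (begin
  P (suc l) (suc n) (ℤtoℚ e) (ℤtoℚ x)
    ≡⟨ P-at-integers (suc l) (suc n) e x N (proj₂ (innerSum≡F x)) ⟩
  w ℚ.* ℤtoℚ (∑ (suc n) (λ k → e ^ k * odd k ^ (2 ℕ.* suc l ∸ 1) * F N k))
    ≡⟨ cong (λ E → w ℚ.* ℤtoℚ (∑ (suc n) (λ k → e ^ k * odd k ^ E * F N k))) (cong (_∸ 1) (ℕP.*-suc 2 l)) ⟩
  w ℚ.* ℤtoℚ (∑ (suc n) (λ k → e ^ k * odd k ^ suc (2 ℕ.* l) * F N k))
    ≡⟨ cong (λ t → w ℚ.* ℤtoℚ t) (_∣_.equality n∣∑) ⟩
  w ℚ.* ℤtoℚ (quotient n∣∑ * + suc n)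
    ≡⟨ ℚP.*-comm w (ℤtoℚ (quotient n∣∑ * + suc n)) ⟩
  ℤtoℚ (quotient n∣∑ * + suc n) ℚ.* w
    ≡⟨ ℤtoℚ-*-/ (quotient n∣∑) n ⟩
  ℤtoℚ (quotient n∣∑) ∎)
  where
  w : ℚ
  w = + 1 ℚ./ suc n
  N : ℕ
  N = proj₁ (innerSum≡F x)
  n∣∑ : + suc n ∣ ∑ (suc n) (λ k → e ^ k * odd k ^ suc (2 ℕ.* l) * F N k)
  n∣∑ = ∑-F-divisible e≡±1 (suc n) l N

theorem1p2 : (l n : ℕ) → l ≥ 1 → .{{_ : NonZero n}} → (ε : ℚ) → (ε ≡ 1ℚ ⊎ ε ≡ - 1ℚ) →
    (x : ℤ) → ∃ λ (z : ℤ) → P l n ε (ℤtoℚ x) ≡ ℤtoℚ z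
theorem1p2 (suc l) (suc n) _ ε ε≡±1 x with ±1-from-ℚ ε≡±1
... | e , e≡±1 , refl = P-integral l n e≡±1 x
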